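{- There exists a total function $f:\omega\to\omega$ which is not computably bounded (there is no total computable $b$ with $f(x)\le b(x)$ for all $x$), yet is bounded-Turing equivalent to the characteristic function of its own graph $G=\{\langle x,f(x)\rangle:x\in\omega\}$.
   Context: Subsets of $\omega^2$ are identified with subsets of $\omega$ via a fixed computable pairing. For total $\alpha,\beta:\omega\to\omega$, $\alpha\le_{bT}\beta$ if there are a Turing reduction $\Phi$ using $\beta$ as a function oracle (queried for values $\beta(y)$) and a total computable $b$ such that for each $x$, $\Phi$ computes $\alpha(x)$ querying only values $\beta(y)$ with $y<b(x)$; bounded-Turing equivalence means $\le_{bT}$ in both directions. -}

module Defs where

open import Data.Nat using (ℕ; zero; suc; _+_; _≤_; _<?_; _≟_)
open import Data.Fin using (Fin)
open import Data.Vec using (Vec; []; _∷_; lookup)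
open import Data.Maybe using (Maybe; just; nothing)
open import Data.Product using (Σ; _×_; _,_)
open import Data.List using (upTo)
open import Data.List.Relation.Unary.Any using (any?)
open import Relation.Nullary using (¬_; does)
open import Relation.Binary.PropositionalEquality using (_≡_)
open import Data.Bool using (if_then_else_)

-- An oracle is a *partial* function ℕ → Maybe ℕ; a query
-- at a point where the oracle is `nothing` gets stuck (no derivation),
-- which is how query bounds are enforced.

data Code : ℕ → Set where
  zer    : ∀ {n} → Code n
  succ   : Code 1
  proj   : ∀ {n} → Fin n → Code n
  orac   : Code 1
  comp   : ∀ {m n} → Code m → Vec (Code n) m → Code n
  prec   : ∀ {n} → Code n → Code (suc (suc n)) → Code (suc n)
  mu     : ∀ {n} → Code (suc n) → Code n

Oracle : Set
Oracle = ℕ → Maybe ℕ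

mutual
  data Eval (O : Oracle) : ∀ {n} → Code n → Vec ℕ n → ℕ → Set where
    e-zer  : ∀ {n} {xs : Vec ℕ n} → Eval O zer xs 0
    e-succ : ∀ {x} → Eval O succ (x ∷ []) (suc x)
    e-proj : ∀ {n} {i : Fin n} {xs} → Eval O (proj i) xs (lookup xs i)
    e-orac : ∀ {x v} → O x ≡ just v → Eval O orac (x ∷ []) v
    e-comp : ∀ {m n} {f : Code m} {gs : Vec (Code n) m} {xs ys v} →
             EvalAll O xs gs ys → Eval O f ys v → Eval O (comp f gs) xs v
    e-prec0 : ∀ {n} {f : Code n} {g} {xs v} →
             Eval O f xs v → Eval O (prec f g) (0 ∷ xs) v
    e-precS : ∀ {n} {f : Code n} {g} {k xs u v} →
             Eval O (prec f g) (k ∷ xs) u → Eval O g (k ∷ u ∷ xs) v →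
             Eval O (prec f g) (suc k ∷ xs) v
    e-mu   : ∀ {n} {f : Code (suc n)} {xs m} →
             Eval O f (m ∷ xs) 0 → Below O f xs m → Eval O (mu f) xs m

  data EvalAll (O : Oracle) {n} (xs : Vec ℕ n) : ∀ {m} → Vec (Code n) m → Vec ℕ m → Set where
    []  : EvalAll O xs [] []
    _∷_ : ∀ {m g v} {gs : Vec (Code n) m} {vs} →
          Eval O g xs v → EvalAll O xs gs vs → EvalAll O xs (g ∷ gs) (v ∷ vs)

  data Below (O : Oracle) {n} (f : Code (suc n)) (xs : Vec ℕ n) : ℕ → Set where
    b-zero : Below O f xs 0
    b-suc  : ∀ {m w} → Below O f xs m → Eval O f (m ∷ xs) (suc w) → Below O f xs (suc m)

noOracle : Oracle
noOracle _ = nothing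

Computable : (ℕ → ℕ) → Set
Computable b = Σ (Code 1) λ c → ∀ x → Eval noOracle c (x ∷ []) (b x)

ComputablyBounded : (ℕ → ℕ) → Set
ComputablyBounded f = Σ (ℕ → ℕ) λ b → Computable b × (∀ x → f x ≤ b x)

restrict : (ℕ → ℕ) → ℕ → Oracle
restrict β n y = if does (y <? n) then just (β y) else nothing

_≤bT_ : (ℕ → ℕ) → (ℕ → ℕ) → Set
α ≤bT β = Σ (Code 1) λ Φ → Σ (ℕ → ℕ) λ b →
          Computable b × (∀ x → Eval (restrict β (b x)) Φ (x ∷ []) (α x))

_≡bT_ : (ℕ → ℕ) → (ℕ → ℕ) → Set
α ≡bT β = (α ≤bT β) × (β ≤bT α)

tri : ℕ → ℕ
tri zero    = zero
tri (suc k) = suc k + tri k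

pair : ℕ → ℕ → ℕ
pair x y = tri (x + y) + y

-- characteristic function of the graph G = {⟨x, f x⟩ : x ∈ ω}.
-- Since pair x y ≥ x, n ∈ G iff pair x (f x) = n for some x ≤ n.
graphχ : (ℕ → ℕ) → ℕ → ℕ
graphχ f n =
  if does (any? (λ x → pair x (f x) ≟ n) (upTo (suc n))) then 1 else 0

-- Using excluded middle, let d ≤ x be a program number whose output Ψ (2x+1 , d) is largest
-- among the programs d ≤ x halting on 2x+1, and put f (2x) = d + 1 and f (2x+1) = Ψ (2x+1 , d) + 1
-- (both 0 if there is no such program). A computable bound with program number e then fails at
-- 2e+1. Conversely f (2x) ≤ x + 1 can be read off the graph G by the queries ⟨2x , y⟩ with
-- y ≤ x + 1, after which f (2x+1) is computed by running program d; so f ≤bT G with a computable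
-- query bound. G ≤bT f because ⟨x , f x⟩ = n forces x ≤ n. The universal function Ψ comes from a
-- machine for the codes whose single step is primitive recursive.

module Submission where

open import Defs
open import Level using (0ℓ)
open import Axiom.ExcludedMiddle using (ExcludedMiddle)
open import Data.Bool using (if_then_else_)
open import Data.Empty using (⊥-elim)
open import Data.Fin using (Fin; toℕ) renaming (zero to fz; suc to fs)
open import Data.List using (upTo)
open import Data.List.Membership.Propositional using (lose)
open import Data.List.Membership.Propositional.Properties using (∈-upTo⁺)
open import Data.List.Relation.Unary.Any using (any?; satisfied)
open import Data.Maybe using (Maybe; just; nothing)
open import Data.Nat using (ℕ; zero; suc; _+_; _*_; _∸_; _≤_; _<_; z≤n; s≤s; pred; ∣_-_∣; _≟_; _≤?_; _<?_)
open import Data.Nat.Properties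
open import Data.Product using (Σ; ∃; _×_; _,_; proj₁; proj₂)
open import Data.Sum using (_⊎_; inj₁; inj₂)
open import Data.Unit using (⊤)
open import Data.Vec using (Vec; []; _∷_; lookup)
open import Relation.Binary using (tri<; tri≈; tri>)
open import Relation.Binary.PropositionalEquality
open import Relation.Nullary using (¬_; Dec; yes; no)
open import Relation.Nullary.Decidable using (dec-true; dec-false)

ifz : ℕ → ℕ → ℕ → ℕ
ifz zero    a b = a
ifz (suc _) a b = b

ifz-≢0 : ∀ n a b → n ≢ 0 → ifz n a b ≡ b
ifz-≢0 zero    a b n≢0 = ⊥-elim (n≢0 refl)
ifz-≢0 (suc n) a b n≢0 = refl

∣m-n∣≡[m∸n]+[n∸m] : ∀ m n → ∣ m - n ∣ ≡ (m ∸ n) + (n ∸ m)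
∣m-n∣≡[m∸n]+[n∸m] zero    n       = sym (cong (_+ n) (0∸n≡0 n))
∣m-n∣≡[m∸n]+[n∸m] (suc m) zero    = sym (+-identityʳ (suc m))
∣m-n∣≡[m∸n]+[n∸m] (suc m) (suc n) = ∣m-n∣≡[m∸n]+[n∸m] m n

tri-mono-≤ : ∀ {a b} → a ≤ b → tri a ≤ tri b
tri-mono-≤ z≤n     = z≤n
tri-mono-≤ (s≤s p) = +-mono-≤ (s≤s p) (tri-mono-≤ p)

n≤tri[n] : ∀ n → n ≤ tri n
n≤tri[n] zero    = z≤n
n≤tri[n] (suc n) = s≤s (m≤m+n n _)

x≤pair[x,y] : ∀ x y → x ≤ pair x y
x≤pair[x,y] x y = ≤-trans (m≤m+n x y) (≤-trans (n≤tri[n] (x + y)) (m≤m+n _ _))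

pair-mono-≤ : ∀ {x y x' y'} → x ≤ x' → y ≤ y' → pair x y ≤ pair x' y'
pair-mono-≤ x≤x' y≤y' = +-mono-≤ (tri-mono-≤ (+-mono-≤ x≤x' y≤y')) y≤y'

-- The code following n starts a new diagonal exactly when n is the last code tri s + s of its own.
diagonal : ℕ → ℕ
diagonal zero    = 0
diagonal (suc n) = ifz ∣ n ∸ tri (diagonal n) - diagonal n ∣ (suc (diagonal n)) (diagonal n)

OnDiagonal : ℕ → ℕ → Set
OnDiagonal s n = tri s ≤ n × n ≤ tri s + s

onDiagonal-diagonal : ∀ n → OnDiagonal (diagonal n) n
onDiagonal-diagonal zero = z≤n , z≤n
onDiagonal-diagonal (suc n) with diagonal n | onDiagonal-diagonal n
... | s | (lo , hi) with ∣ n ∸ tri s - s ∣ in eq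
...   | zero = ≤-reflexive tri[1+s]≡1+n , ≤-trans (≤-reflexive (sym tri[1+s]≡1+n)) (m≤m+n _ _)
  where
  n≡tri[s]+s : n ≡ tri s + s
  n≡tri[s]+s = trans (sym (m+[n∸m]≡n lo)) (cong (tri s +_) (∣m-n∣≡0⇒m≡n eq))
  tri[1+s]≡1+n : tri (suc s) ≡ suc n
  tri[1+s]≡1+n = cong suc (trans (+-comm s (tri s)) (sym n≡tri[s]+s))
...   | suc _ = ≤-trans lo (n≤1+n n) , n<tri[s]+s
  where
  n<tri[s]+s : n < tri s + s
  n<tri[s]+s with m≤n⇒m<n∨m≡n hi
  ... | inj₁ n<  = n<
  ... | inj₂ n≡ with () ← trans (sym eq) (trans (cong (λ z → ∣ z ∸ tri s - s ∣) n≡)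
                                       (trans (cong ∣_- s ∣ (m+n∸m≡n (tri s) s)) (∣n-n∣≡0 s)))

onDiagonal-≮ : ∀ {s s' n} → OnDiagonal s n → OnDiagonal s' n → ¬ s < s'
onDiagonal-≮ {s} (_ , hi) (lo' , _) s<s' =
  <-irrefl refl (≤-trans (tri-mono-≤ s<s') (≤-trans lo' (≤-trans hi (≤-reflexive (+-comm (tri s) s)))))

onDiagonal-unique : ∀ {s s' n} → OnDiagonal s n → OnDiagonal s' n → s ≡ s'
onDiagonal-unique {s} {s'} d d' with <-cmp s s'
... | tri< s<s' _ _ = ⊥-elim (onDiagonal-≮ d d' s<s')
... | tri≈ _ s≡s' _ = s≡s'
... | tri> _ _ s'<s = ⊥-elim (onDiagonal-≮ d' d s'<s)

diagonal-pair : ∀ x y → diagonal (pair x y) ≡ x + y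
diagonal-pair x y =
  onDiagonal-unique (onDiagonal-diagonal (pair x y)) (m≤m+n _ _ , +-monoʳ-≤ (tri (x + y)) (m≤n+m y x))

-- An opaque copy ⟨_,_⟩ of pair keeps the number-coded data structures below from unfolding
-- during type checking.
opaque
  π₂ : ℕ → ℕ
  π₂ n = n ∸ tri (diagonal n)

  π₁ : ℕ → ℕ
  π₁ n = diagonal n ∸ π₂ n

  π₁-def : ∀ n → π₁ n ≡ diagonal n ∸ π₂ n
  π₁-def n = refl

  π₂-def : ∀ n → π₂ n ≡ n ∸ tri (diagonal n)
  π₂-def n = refl

  π₂-pair : ∀ x y → π₂ (pair x y) ≡ y
  π₂-pair x y rewrite diagonal-pair x y = m+n∸m≡n (tri (x + y)) y

  π₁-pair : ∀ x y → π₁ (pair x y) ≡ x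
  π₁-pair x y rewrite π₂-pair x y | diagonal-pair x y = m+n∸n≡m x y

  pair-injective : ∀ {x y x' y'} → pair x y ≡ pair x' y' → x ≡ x' × y ≡ y'
  pair-injective {x} {y} {x'} {y'} eq =
    trans (sym (π₁-pair x y)) (trans (cong π₁ eq) (π₁-pair x' y')) ,
    trans (sym (π₂-pair x y)) (trans (cong π₂ eq) (π₂-pair x' y'))

  pair-π : ∀ n → pair (π₁ n) (π₂ n) ≡ n
  pair-π n = trans (cong (λ s → tri s + π₂ n) π₁+π₂≡diagonal) (m+[n∸m]≡n lo)
    where
    lo : tri (diagonal n) ≤ n
    lo = proj₁ (onDiagonal-diagonal n)
    hi : n ≤ tri (diagonal n) + diagonal n
    hi = proj₂ (onDiagonal-diagonal n)
    π₂≤diagonal : π₂ n ≤ diagonal n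
    π₂≤diagonal = ≤-trans (∸-monoˡ-≤ (tri (diagonal n)) hi) (≤-reflexive (m+n∸m≡n (tri (diagonal n)) (diagonal n)))
    π₁+π₂≡diagonal : π₁ n + π₂ n ≡ diagonal n
    π₁+π₂≡diagonal = m∸n+n≡m π₂≤diagonal

  ⟨_,_⟩ : ℕ → ℕ → ℕ
  ⟨_,_⟩ = pair

  ⟨,⟩-def : ∀ a b → ⟨ a , b ⟩ ≡ pair a b
  ⟨,⟩-def a b = refl

π₁-⟨,⟩ : ∀ x y → π₁ ⟨ x , y ⟩ ≡ x
π₁-⟨,⟩ x y = trans (cong π₁ (⟨,⟩-def x y)) (π₁-pair x y)

π₂-⟨,⟩ : ∀ x y → π₂ ⟨ x , y ⟩ ≡ y
π₂-⟨,⟩ x y = trans (cong π₂ (⟨,⟩-def x y)) (π₂-pair x y)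

⟨π₁,π₂⟩ : ∀ n → ⟨ π₁ n , π₂ n ⟩ ≡ n
⟨π₁,π₂⟩ n = trans (⟨,⟩-def _ _) (pair-π n)

⟨,⟩-injective : ∀ {x y x' y'} → ⟨ x , y ⟩ ≡ ⟨ x' , y' ⟩ → x ≡ x' × y ≡ y'
⟨,⟩-injective {x} {y} {x'} {y'} eq = pair-injective (trans (sym (⟨,⟩-def x y)) (trans eq (⟨,⟩-def x' y')))

-- Oracle-free programs

record Prim (n : ℕ) (F : Vec ℕ n → ℕ) : Set where
  constructor prim
  field
    code : Code n
    runs : ∀ {O} xs → Eval O code xs (F xs)
open Prim public

arg₀ : ∀ {n} → Vec ℕ (suc n) → ℕ
arg₀ xs = lookup xs fz

arg₁ : ∀ {n} → Vec ℕ (suc (suc n)) → ℕ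
arg₁ xs = lookup xs (fs fz)

arg₂ : ∀ {n} → Vec ℕ (suc (suc (suc n))) → ℕ
arg₂ xs = lookup xs (fs (fs fz))

arg₃ : ∀ {n} → Vec ℕ (suc (suc (suc (suc n)))) → ℕ
arg₃ xs = lookup xs (fs (fs (fs fz)))

cast : ∀ {n F G} → (∀ xs → F xs ≡ G xs) → Prim n F → Prim n G
cast F≗G (prim c r) = prim c (λ xs → subst (Eval _ c xs) (F≗G xs) (r xs))

var : ∀ {n} (i : Fin n) → Prim n (λ xs → lookup xs i)
var i = prim (proj i) (λ xs → e-proj)

var₀ : ∀ {n} → Prim (suc n) arg₀
var₀ = var fz

var₁ : ∀ {n} → Prim (suc (suc n)) arg₁
var₁ = var (fs fz)

var₂ : ∀ {n} → Prim (suc (suc (suc n))) arg₂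
var₂ = var (fs (fs fz))

var₃ : ∀ {n} → Prim (suc (suc (suc (suc n)))) arg₃
var₃ = var (fs (fs (fs fz)))

comp₁ : ∀ {n F G} → Prim 1 F → Prim n G → Prim n (λ xs → F (G xs ∷ []))
comp₁ f g = prim (comp (code f) (code g ∷ [])) (λ xs → e-comp (runs g xs ∷ []) (runs f _))

comp₂ : ∀ {n F G H} → Prim 2 F → Prim n G → Prim n H → Prim n (λ xs → F (G xs ∷ H xs ∷ []))
comp₂ f g h = prim (comp (code f) (code g ∷ code h ∷ []))
  (λ xs → e-comp (runs g xs ∷ runs h xs ∷ []) (runs f _))

comp₃ : ∀ {n F G H I} → Prim 3 F → Prim n G → Prim n H → Prim n I →
        Prim n (λ xs → F (G xs ∷ H xs ∷ I xs ∷ []))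
comp₃ f g h i = prim (comp (code f) (code g ∷ code h ∷ code i ∷ []))
  (λ xs → e-comp (runs g xs ∷ runs h xs ∷ runs i xs ∷ []) (runs f _))

rec : ∀ {n} → (Vec ℕ n → ℕ) → (Vec ℕ (suc (suc n)) → ℕ) → Vec ℕ (suc n) → ℕ
rec F G (zero  ∷ xs) = F xs
rec F G (suc k ∷ xs) = G (k ∷ rec F G (k ∷ xs) ∷ xs)

primRec : ∀ {n F G} → Prim n F → Prim (suc (suc n)) G → Prim (suc n) (rec F G)
primRec {F = F} {G} f g = prim (prec (code f) (code g)) run
  where
  run : ∀ {O} xs → Eval O (prec (code f) (code g)) xs (rec F G xs)
  run (zero  ∷ xs) = e-prec0 (runs f xs)
  run (suc k ∷ xs) = e-precS (run (k ∷ xs)) (runs g _)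

module _ {n : ℕ} where
  sucᵖ : ∀ {F} → Prim n F → Prim n (λ xs → suc (F xs))
  sucᵖ g = prim (comp succ (code g ∷ [])) (λ xs → e-comp (runs g xs ∷ []) e-succ)

  constᵖ : ∀ k → Prim n (λ _ → k)
  constᵖ zero    = prim zer (λ xs → e-zer)
  constᵖ (suc k) = sucᵖ (constᵖ k)

prim+ : Prim 2 (λ xs → arg₀ xs + arg₁ xs)
prim+ = cast rec≗+ (primRec var₀ (sucᵖ var₁))
  where
  rec≗+ : ∀ xs → rec arg₀ (λ ys → suc (arg₁ ys)) xs ≡ arg₀ xs + arg₁ xs
  rec≗+ (zero  ∷ b ∷ []) = refl
  rec≗+ (suc a ∷ b ∷ []) = cong suc (rec≗+ (a ∷ b ∷ []))

primPred : Prim 1 (λ xs → pred (arg₀ xs))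
primPred = cast rec≗pred (primRec (constᵖ 0) var₀)
  where
  rec≗pred : ∀ xs → rec (λ _ → 0) arg₀ xs ≡ pred (arg₀ xs)
  rec≗pred (zero  ∷ []) = refl
  rec≗pred (suc a ∷ []) = refl

prim∸ : Prim 2 (λ xs → arg₀ xs ∸ arg₁ xs)
prim∸ = cast rec≗∸ (comp₂ (primRec var₀ (comp₁ primPred var₁)) var₁ var₀)
  where
  rec≗a∸k : ∀ k a → rec arg₀ (λ ys → pred (arg₁ ys)) (k ∷ a ∷ []) ≡ a ∸ k
  rec≗a∸k zero    a = refl
  rec≗a∸k (suc k) a = trans (cong pred (rec≗a∸k k a)) (pred[m∸n]≡m∸[1+n] a k)
  rec≗∸ : ∀ xs → rec arg₀ (λ ys → pred (arg₁ ys)) (arg₁ xs ∷ arg₀ xs ∷ []) ≡ arg₀ xs ∸ arg₁ xs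
  rec≗∸ (a ∷ b ∷ []) = rec≗a∸k b a

prim* : Prim 2 (λ xs → arg₀ xs * arg₁ xs)
prim* = cast rec≗* (primRec (constᵖ 0) (comp₂ prim+ var₁ var₂))
  where
  rec≗* : ∀ xs → rec (λ _ → 0) (λ ys → arg₁ ys + arg₂ ys) xs ≡ arg₀ xs * arg₁ xs
  rec≗* (zero  ∷ b ∷ []) = refl
  rec≗* (suc a ∷ b ∷ []) = trans (cong (_+ b) (rec≗* (a ∷ b ∷ []))) (+-comm (a * b) b)

primTri : Prim 1 (λ xs → tri (arg₀ xs))
primTri = cast rec≗tri (primRec (constᵖ 0) (comp₂ prim+ (sucᵖ var₀) var₁))
  where
  rec≗tri : ∀ xs → rec (λ _ → 0) (λ ys → suc (arg₀ ys) + arg₁ ys) xs ≡ tri (arg₀ xs)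
  rec≗tri (zero  ∷ []) = refl
  rec≗tri (suc a ∷ []) = cong (suc a +_) (rec≗tri (a ∷ []))

primIfz : Prim 3 (λ xs → ifz (arg₀ xs) (arg₁ xs) (arg₂ xs))
primIfz = cast rec≗ifz (primRec var₀ var₃)
  where
  rec≗ifz : ∀ xs → rec arg₀ arg₃ xs ≡ ifz (arg₀ xs) (arg₁ xs) (arg₂ xs)
  rec≗ifz (zero  ∷ a ∷ b ∷ []) = refl
  rec≗ifz (suc c ∷ a ∷ b ∷ []) = refl

module _ {n : ℕ} where
  infixl 6 _+ᵖ_ _∸ᵖ_
  infixl 7 _*ᵖ_

  _+ᵖ_ : ∀ {F G} → Prim n F → Prim n G → Prim n (λ xs → F xs + G xs)
  _+ᵖ_ = comp₂ prim+

  _∸ᵖ_ : ∀ {F G} → Prim n F → Prim n G → Prim n (λ xs → F xs ∸ G xs)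
  _∸ᵖ_ = comp₂ prim∸

  _*ᵖ_ : ∀ {F G} → Prim n F → Prim n G → Prim n (λ xs → F xs * G xs)
  _*ᵖ_ = comp₂ prim*

  predᵖ : ∀ {F} → Prim n F → Prim n (λ xs → pred (F xs))
  predᵖ = comp₁ primPred

  triᵖ : ∀ {F} → Prim n F → Prim n (λ xs → tri (F xs))
  triᵖ = comp₁ primTri

  ifzᵖ : ∀ {F G H} → Prim n F → Prim n G → Prim n H → Prim n (λ xs → ifz (F xs) (G xs) (H xs))
  ifzᵖ = comp₃ primIfz

  ∣_-_∣ᵖ : ∀ {F G} → Prim n F → Prim n G → Prim n (λ xs → ∣ F xs - G xs ∣)
  ∣_-_∣ᵖ {F} {G} g h = cast (λ xs → sym (∣m-n∣≡[m∸n]+[n∸m] (F xs) (G xs))) ((g ∸ᵖ h) +ᵖ (h ∸ᵖ g))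

  pairᵖ : ∀ {F G} → Prim n F → Prim n G → Prim n (λ xs → pair (F xs) (G xs))
  pairᵖ g h = triᵖ (g +ᵖ h) +ᵖ h

primDiagonal : Prim 1 (λ xs → diagonal (arg₀ xs))
primDiagonal = cast rec≗diagonal (primRec (constᵖ 0) (ifzᵖ ∣ var₀ ∸ᵖ triᵖ var₁ - var₁ ∣ᵖ (sucᵖ var₁) var₁))
  where
  rec≗diagonal : ∀ xs → rec (λ _ → 0) (λ ys → ifz ∣ arg₀ ys ∸ tri (arg₁ ys) - arg₁ ys ∣ (suc (arg₁ ys)) (arg₁ ys)) xs
                        ≡ diagonal (arg₀ xs)
  rec≗diagonal (zero  ∷ []) = refl
  rec≗diagonal (suc a ∷ []) = cong (λ s → ifz ∣ a ∸ tri s - s ∣ (suc s) s) (rec≗diagonal (a ∷ []))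

primπ₂ : Prim 1 (λ xs → π₂ (arg₀ xs))
primπ₂ = cast (λ xs → sym (π₂-def (arg₀ xs))) (var₀ ∸ᵖ triᵖ (comp₁ primDiagonal var₀))

primπ₁ : Prim 1 (λ xs → π₁ (arg₀ xs))
primπ₁ = cast (λ xs → sym (π₁-def (arg₀ xs))) (comp₁ primDiagonal var₀ ∸ᵖ comp₁ primπ₂ var₀)

module _ {n : ℕ} where
  π₁ᵖ : ∀ {F} → Prim n F → Prim n (λ xs → π₁ (F xs))
  π₁ᵖ = comp₁ primπ₁

  π₂ᵖ : ∀ {F} → Prim n F → Prim n (λ xs → π₂ (F xs))
  π₂ᵖ = comp₁ primπ₂

  ⟨_,_⟩ᵖ : ∀ {F G} → Prim n F → Prim n G → Prim n (λ xs → ⟨ F xs , G xs ⟩)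
  ⟨ g , h ⟩ᵖ = cast (λ xs → sym (⟨,⟩-def _ _)) (pairᵖ g h)

-- A universal machine

cons : ℕ → ℕ → ℕ
cons a l = suc ⟨ a , l ⟩

hd : ℕ → ℕ
hd l = π₁ (pred l)

tl : ℕ → ℕ
tl l = π₂ (pred l)

hd-cons : ∀ a l → hd (cons a l) ≡ a
hd-cons = π₁-⟨,⟩

tl-cons : ∀ a l → tl (cons a l) ≡ l
tl-cons = π₂-⟨,⟩

tlⁿ : ℕ → ℕ → ℕ
tlⁿ zero    l = l
tlⁿ (suc k) l = tl (tlⁿ k l)

tlⁿ-suc : ∀ k l → tlⁿ (suc k) l ≡ tlⁿ k (tl l)
tlⁿ-suc zero    l = refl
tlⁿ-suc (suc k) l = cong tl (tlⁿ-suc k l)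

nth : ℕ → ℕ → ℕ
nth l i = hd (tlⁿ i l)

pushVec : ∀ {m} → Vec ℕ m → ℕ → ℕ
pushVec []       l = l
pushVec (v ∷ vs) l = cons v (pushVec vs l)

encodeVec : ∀ {m} → Vec ℕ m → ℕ
encodeVec vs = pushVec vs 0

nth-encodeVec : ∀ {n} (xs : Vec ℕ n) (i : Fin n) → nth (encodeVec xs) (toℕ i) ≡ lookup xs i
nth-encodeVec (x ∷ xs) fz     = hd-cons x (encodeVec xs)
nth-encodeVec (x ∷ xs) (fs i) = begin
  hd (tlⁿ (suc (toℕ i)) (encodeVec (x ∷ xs))) ≡⟨ cong hd (tlⁿ-suc (toℕ i) _) ⟩
  hd (tlⁿ (toℕ i) (tl (cons x (encodeVec xs)))) ≡⟨ cong (λ l → hd (tlⁿ (toℕ i) l)) (tl-cons x _) ⟩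
  nth (encodeVec xs) (toℕ i)                     ≡⟨ nth-encodeVec xs i ⟩
  lookup xs i                                    ∎
  where open ≡-Reasoning

-- encodeArgs lists the argument codes of a composition in reverse order.
mutual
  encode : ∀ {n} → Code n → ℕ
  encode zer         = ⟨ 0 , 0 ⟩
  encode succ        = ⟨ 1 , 0 ⟩
  encode (proj i)    = ⟨ 2 , toℕ i ⟩
  encode orac        = ⟨ 3 , 0 ⟩
  encode (comp f gs) = ⟨ 4 , ⟨ encode f , encodeArgs gs 0 ⟩ ⟩
  encode (prec f g)  = ⟨ 5 , ⟨ encode f , encode g ⟩ ⟩
  encode (mu f)      = ⟨ 6 , encode f ⟩

  encodeArgs : ∀ {n m} → Vec (Code n) m → ℕ → ℕ
  encodeArgs []       acc = acc
  encodeArgs (g ∷ gs) acc = encodeArgs gs (cons (encode g) acc)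

-- A state either evaluates a code on an argument list, returns a value, or evaluates the
-- argument codes gs of a composition, collecting their values in acc; K is a stack of frames
-- recording what to do with a returned value.

evalS : ℕ → ℕ → ℕ → ℕ
evalS e xs K = ⟨ 0 , ⟨ e , ⟨ xs , K ⟩ ⟩ ⟩

returnS : ℕ → ℕ → ℕ
returnS v K = ⟨ 1 , ⟨ v , K ⟩ ⟩

argsS : ℕ → ℕ → ℕ → ℕ → ℕ → ℕ
argsS ef gs xs acc K = ⟨ 2 , ⟨ ef , ⟨ gs , ⟨ xs , ⟨ acc , K ⟩ ⟩ ⟩ ⟩ ⟩

compF : ℕ → ℕ → ℕ → ℕ → ℕ
compF ef gs xs acc = ⟨ 0 , ⟨ ef , ⟨ gs , ⟨ xs , acc ⟩ ⟩ ⟩ ⟩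

precF : ℕ → ℕ → ℕ → ℕ → ℕ
precF eg k i xs = ⟨ 1 , ⟨ eg , ⟨ k , ⟨ i , xs ⟩ ⟩ ⟩ ⟩

muF : ℕ → ℕ → ℕ → ℕ
muF ef m xs = ⟨ 2 , ⟨ ef , ⟨ m , xs ⟩ ⟩ ⟩

case₇ : ℕ → ℕ → ℕ → ℕ → ℕ → ℕ → ℕ → ℕ → ℕ
case₇ t a₀ a₁ a₂ a₃ a₄ a₅ a₆ =
  ifz t a₀ (ifz (pred t) a₁ (ifz (pred (pred t)) a₂ (ifz (pred (pred (pred t))) a₃
  (ifz (pred (pred (pred (pred t)))) a₄ (ifz (pred (pred (pred (pred (pred t))))) a₅ a₆)))))

-- An oracle query (tag 3) leaves the state unchanged, so it never halts.
evalStep : ℕ → ℕ → ℕ → ℕ → ℕ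
evalStep t cb xs K = case₇ t
  (returnS 0 K)
  (returnS (suc (hd xs)) K)
  (returnS (nth xs cb) K)
  (evalS ⟨ t , cb ⟩ xs K)
  (argsS (π₁ cb) (π₂ cb) xs 0 K)
  (evalS (π₁ cb) (tl xs) (cons (precF (π₂ cb) (hd xs) 0 (tl xs)) K))
  (evalS cb (cons 0 xs) (cons (muF cb 0 xs) K))

precFrameStep : ℕ → ℕ → ℕ → ℕ → ℕ → ℕ → ℕ
precFrameStep v K eg k i xs =
  ifz ∣ i - k ∣ (returnS v K) (evalS eg (cons i (cons v xs)) (cons (precF eg k (suc i) xs) K))

muFrameStep : ℕ → ℕ → ℕ → ℕ → ℕ → ℕ
muFrameStep v K ef m xs = ifz v (returnS m K) (evalS ef (cons (suc m) xs) (cons (muF ef (suc m) xs) K))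

frameStep : ℕ → ℕ → ℕ → ℕ → ℕ
frameStep v ft fb K =
  ifz ft (argsS (π₁ fb) (π₁ (π₂ fb)) (π₁ (π₂ (π₂ fb))) (cons v (π₂ (π₂ (π₂ fb)))) K)
  (ifz (pred ft)
     (precFrameStep v K (π₁ fb) (π₁ (π₂ fb)) (π₁ (π₂ (π₂ fb))) (π₂ (π₂ (π₂ fb))))
     (muFrameStep v K (π₁ fb) (π₁ (π₂ fb)) (π₂ (π₂ fb))))

returnStep : ℕ → ℕ → ℕ
returnStep v K = ifz K (returnS v K) (frameStep v (π₁ (hd K)) (π₂ (hd K)) (tl K))

argsStep : ℕ → ℕ → ℕ → ℕ → ℕ → ℕ
argsStep ef gs xs acc K = ifz gs (evalS ef acc K) (evalS (hd gs) xs (cons (compF ef (tl gs) xs acc) K))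

step : ℕ → ℕ
step s = ifz (π₁ s)
  (evalStep (π₁ (π₁ b)) (π₂ (π₁ b)) (π₁ (π₂ b)) (π₂ (π₂ b)))
  (ifz (pred (π₁ s))
    (returnStep (π₁ b) (π₂ b))
    (argsStep (π₁ b) (π₁ (π₂ b)) (π₁ (π₂ (π₂ b))) (π₁ (π₂ (π₂ (π₂ b)))) (π₂ (π₂ (π₂ (π₂ b))))))
  where b = π₂ s

primTlⁿ : Prim 2 (λ xs → tlⁿ (arg₀ xs) (arg₁ xs))
primTlⁿ = cast rec≗tlⁿ (primRec var₀ (π₂ᵖ (predᵖ var₁)))
  where
  rec≗tlⁿ : ∀ xs → rec arg₀ (λ ys → π₂ (pred (arg₁ ys))) xs ≡ tlⁿ (arg₀ xs) (arg₁ xs)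
  rec≗tlⁿ (zero  ∷ l ∷ []) = refl
  rec≗tlⁿ (suc k ∷ l ∷ []) = cong tl (rec≗tlⁿ (k ∷ l ∷ []))

module _ {n : ℕ} where
  consᵖ : ∀ {F G} → Prim n F → Prim n G → Prim n (λ xs → cons (F xs) (G xs))
  consᵖ g h = sucᵖ ⟨ g , h ⟩ᵖ

  hdᵖ : ∀ {F} → Prim n F → Prim n (λ xs → hd (F xs))
  hdᵖ g = π₁ᵖ (predᵖ g)

  tlᵖ : ∀ {F} → Prim n F → Prim n (λ xs → tl (F xs))
  tlᵖ g = π₂ᵖ (predᵖ g)

  nthᵖ : ∀ {F G} → Prim n F → Prim n G → Prim n (λ xs → nth (F xs) (G xs))
  nthᵖ g h = hdᵖ (comp₂ primTlⁿ h g)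

  evalSᵖ : ∀ {A B C} → Prim n A → Prim n B → Prim n C → Prim n (λ v → evalS (A v) (B v) (C v))
  evalSᵖ a b c = ⟨ constᵖ 0 , ⟨ a , ⟨ b , c ⟩ᵖ ⟩ᵖ ⟩ᵖ

  returnSᵖ : ∀ {A B} → Prim n A → Prim n B → Prim n (λ v → returnS (A v) (B v))
  returnSᵖ a b = ⟨ constᵖ 1 , ⟨ a , b ⟩ᵖ ⟩ᵖ

  argsSᵖ : ∀ {A B C D E} → Prim n A → Prim n B → Prim n C → Prim n D → Prim n E →
           Prim n (λ v → argsS (A v) (B v) (C v) (D v) (E v))
  argsSᵖ a b c d e = ⟨ constᵖ 2 , ⟨ a , ⟨ b , ⟨ c , ⟨ d , e ⟩ᵖ ⟩ᵖ ⟩ᵖ ⟩ᵖ ⟩ᵖ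

  compFᵖ : ∀ {A B C D} → Prim n A → Prim n B → Prim n C → Prim n D →
           Prim n (λ v → compF (A v) (B v) (C v) (D v))
  compFᵖ a b c d = ⟨ constᵖ 0 , ⟨ a , ⟨ b , ⟨ c , d ⟩ᵖ ⟩ᵖ ⟩ᵖ ⟩ᵖ

  precFᵖ : ∀ {A B C D} → Prim n A → Prim n B → Prim n C → Prim n D →
           Prim n (λ v → precF (A v) (B v) (C v) (D v))
  precFᵖ a b c d = ⟨ constᵖ 1 , ⟨ a , ⟨ b , ⟨ c , d ⟩ᵖ ⟩ᵖ ⟩ᵖ ⟩ᵖ

  muFᵖ : ∀ {A B C} → Prim n A → Prim n B → Prim n C → Prim n (λ v → muF (A v) (B v) (C v))
  muFᵖ a b c = ⟨ constᵖ 2 , ⟨ a , ⟨ b , c ⟩ᵖ ⟩ᵖ ⟩ᵖ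

  case₇ᵖ : ∀ {T A₀ A₁ A₂ A₃ A₄ A₅ A₆} → Prim n T → Prim n A₀ → Prim n A₁ → Prim n A₂ → Prim n A₃ →
           Prim n A₄ → Prim n A₅ → Prim n A₆ →
           Prim n (λ v → case₇ (T v) (A₀ v) (A₁ v) (A₂ v) (A₃ v) (A₄ v) (A₅ v) (A₆ v))
  case₇ᵖ t a₀ a₁ a₂ a₃ a₄ a₅ a₆ =
    ifzᵖ t a₀ (ifzᵖ (predᵖ t) a₁ (ifzᵖ (predᵖ (predᵖ t)) a₂ (ifzᵖ (predᵖ (predᵖ (predᵖ t))) a₃
    (ifzᵖ (predᵖ (predᵖ (predᵖ (predᵖ t)))) a₄ (ifzᵖ (predᵖ (predᵖ (predᵖ (predᵖ (predᵖ t))))) a₅ a₆)))))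

  evalStepᵖ : ∀ {T CB XS K} → Prim n T → Prim n CB → Prim n XS → Prim n K →
              Prim n (λ v → evalStep (T v) (CB v) (XS v) (K v))
  evalStepᵖ t cb xs k = case₇ᵖ t
    (returnSᵖ (constᵖ 0) k)
    (returnSᵖ (sucᵖ (hdᵖ xs)) k)
    (returnSᵖ (nthᵖ xs cb) k)
    (evalSᵖ ⟨ t , cb ⟩ᵖ xs k)
    (argsSᵖ (π₁ᵖ cb) (π₂ᵖ cb) xs (constᵖ 0) k)
    (evalSᵖ (π₁ᵖ cb) (tlᵖ xs) (consᵖ (precFᵖ (π₂ᵖ cb) (hdᵖ xs) (constᵖ 0) (tlᵖ xs)) k))
    (evalSᵖ cb (consᵖ (constᵖ 0) xs) (consᵖ (muFᵖ cb (constᵖ 0) xs) k))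

  precFrameStepᵖ : ∀ {V K EG Bound I XS} → Prim n V → Prim n K → Prim n EG → Prim n Bound → Prim n I →
                   Prim n XS → Prim n (λ v → precFrameStep (V v) (K v) (EG v) (Bound v) (I v) (XS v))
  precFrameStepᵖ v k eg bound i xs =
    ifzᵖ ∣ i - bound ∣ᵖ (returnSᵖ v k) (evalSᵖ eg (consᵖ i (consᵖ v xs)) (consᵖ (precFᵖ eg bound (sucᵖ i) xs) k))

  muFrameStepᵖ : ∀ {V K EF M XS} → Prim n V → Prim n K → Prim n EF → Prim n M → Prim n XS →
                 Prim n (λ v → muFrameStep (V v) (K v) (EF v) (M v) (XS v))
  muFrameStepᵖ v k ef m xs =
    ifzᵖ v (returnSᵖ m k) (evalSᵖ ef (consᵖ (sucᵖ m) xs) (consᵖ (muFᵖ ef (sucᵖ m) xs) k))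

  frameStepᵖ : ∀ {V FT FB K} → Prim n V → Prim n FT → Prim n FB → Prim n K →
               Prim n (λ v → frameStep (V v) (FT v) (FB v) (K v))
  frameStepᵖ v ft fb k =
    ifzᵖ ft (argsSᵖ (π₁ᵖ fb) (π₁ᵖ (π₂ᵖ fb)) (π₁ᵖ (π₂ᵖ (π₂ᵖ fb))) (consᵖ v (π₂ᵖ (π₂ᵖ (π₂ᵖ fb)))) k)
    (ifzᵖ (predᵖ ft)
       (precFrameStepᵖ v k (π₁ᵖ fb) (π₁ᵖ (π₂ᵖ fb)) (π₁ᵖ (π₂ᵖ (π₂ᵖ fb))) (π₂ᵖ (π₂ᵖ (π₂ᵖ fb))))
       (muFrameStepᵖ v k (π₁ᵖ fb) (π₁ᵖ (π₂ᵖ fb)) (π₂ᵖ (π₂ᵖ fb))))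

  returnStepᵖ : ∀ {V K} → Prim n V → Prim n K → Prim n (λ v → returnStep (V v) (K v))
  returnStepᵖ v k = ifzᵖ k (returnSᵖ v k) (frameStepᵖ v (π₁ᵖ (hdᵖ k)) (π₂ᵖ (hdᵖ k)) (tlᵖ k))

  argsStepᵖ : ∀ {A B C D E} → Prim n A → Prim n B → Prim n C → Prim n D → Prim n E →
              Prim n (λ v → argsStep (A v) (B v) (C v) (D v) (E v))
  argsStepᵖ ef gs xs acc k =
    ifzᵖ gs (evalSᵖ ef acc k) (evalSᵖ (hdᵖ gs) xs (consᵖ (compFᵖ ef (tlᵖ gs) xs acc) k))

primStep : Prim 1 (λ xs → step (arg₀ xs))
primStep = ifzᵖ (π₁ᵖ var₀)
  (evalStepᵖ (π₁ᵖ (π₁ᵖ b)) (π₂ᵖ (π₁ᵖ b)) (π₁ᵖ (π₂ᵖ b)) (π₂ᵖ (π₂ᵖ b)))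
  (ifzᵖ (predᵖ (π₁ᵖ var₀))
    (returnStepᵖ (π₁ᵖ b) (π₂ᵖ b))
    (argsStepᵖ (π₁ᵖ b) (π₁ᵖ (π₂ᵖ b)) (π₁ᵖ (π₂ᵖ (π₂ᵖ b))) (π₁ᵖ (π₂ᵖ (π₂ᵖ (π₂ᵖ b)))) (π₂ᵖ (π₂ᵖ (π₂ᵖ (π₂ᵖ b))))))
  where b = π₂ᵖ var₀

step-evalS : ∀ t cb xs K → step (evalS ⟨ t , cb ⟩ xs K) ≡ evalStep t cb xs K
step-evalS t cb xs K
  rewrite π₁-⟨,⟩ 0 ⟨ ⟨ t , cb ⟩ , ⟨ xs , K ⟩ ⟩ | π₂-⟨,⟩ 0 ⟨ ⟨ t , cb ⟩ , ⟨ xs , K ⟩ ⟩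
        | π₁-⟨,⟩ ⟨ t , cb ⟩ ⟨ xs , K ⟩ | π₂-⟨,⟩ ⟨ t , cb ⟩ ⟨ xs , K ⟩
        | π₁-⟨,⟩ t cb | π₂-⟨,⟩ t cb | π₁-⟨,⟩ xs K | π₂-⟨,⟩ xs K = refl

step-returnS : ∀ v K → step (returnS v K) ≡ returnStep v K
step-returnS v K rewrite π₁-⟨,⟩ 1 ⟨ v , K ⟩ | π₂-⟨,⟩ 1 ⟨ v , K ⟩ | π₁-⟨,⟩ v K | π₂-⟨,⟩ v K = refl

step-argsS : ∀ ef gs xs acc K → step (argsS ef gs xs acc K) ≡ argsStep ef gs xs acc K
step-argsS ef gs xs acc K
  rewrite π₁-⟨,⟩ 2 ⟨ ef , ⟨ gs , ⟨ xs , ⟨ acc , K ⟩ ⟩ ⟩ ⟩ | π₂-⟨,⟩ 2 ⟨ ef , ⟨ gs , ⟨ xs , ⟨ acc , K ⟩ ⟩ ⟩ ⟩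
        | π₁-⟨,⟩ ef ⟨ gs , ⟨ xs , ⟨ acc , K ⟩ ⟩ ⟩ | π₂-⟨,⟩ ef ⟨ gs , ⟨ xs , ⟨ acc , K ⟩ ⟩ ⟩
        | π₁-⟨,⟩ gs ⟨ xs , ⟨ acc , K ⟩ ⟩ | π₂-⟨,⟩ gs ⟨ xs , ⟨ acc , K ⟩ ⟩
        | π₁-⟨,⟩ xs ⟨ acc , K ⟩ | π₂-⟨,⟩ xs ⟨ acc , K ⟩ | π₁-⟨,⟩ acc K | π₂-⟨,⟩ acc K = refl

step-halted : ∀ v → step (returnS v 0) ≡ returnS v 0
step-halted v = step-returnS v 0

step-frame : ∀ v ft fb K → step (returnS v (cons ⟨ ft , fb ⟩ K)) ≡ frameStep v ft fb K
step-frame v ft fb K rewrite step-returnS v (cons ⟨ ft , fb ⟩ K)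
  | hd-cons ⟨ ft , fb ⟩ K | tl-cons ⟨ ft , fb ⟩ K | π₁-⟨,⟩ ft fb | π₂-⟨,⟩ ft fb = refl

step-compF : ∀ v ef gs xs acc K →
             step (returnS v (cons (compF ef gs xs acc) K)) ≡ argsS ef gs xs (cons v acc) K
step-compF v ef gs xs acc K rewrite step-frame v 0 ⟨ ef , ⟨ gs , ⟨ xs , acc ⟩ ⟩ ⟩ K
  | π₁-⟨,⟩ ef ⟨ gs , ⟨ xs , acc ⟩ ⟩ | π₂-⟨,⟩ ef ⟨ gs , ⟨ xs , acc ⟩ ⟩
  | π₁-⟨,⟩ gs ⟨ xs , acc ⟩ | π₂-⟨,⟩ gs ⟨ xs , acc ⟩ | π₁-⟨,⟩ xs acc | π₂-⟨,⟩ xs acc = refl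

step-precF : ∀ v eg k i xs K →
             step (returnS v (cons (precF eg k i xs) K)) ≡ precFrameStep v K eg k i xs
step-precF v eg k i xs K rewrite step-frame v 1 ⟨ eg , ⟨ k , ⟨ i , xs ⟩ ⟩ ⟩ K
  | π₁-⟨,⟩ eg ⟨ k , ⟨ i , xs ⟩ ⟩ | π₂-⟨,⟩ eg ⟨ k , ⟨ i , xs ⟩ ⟩
  | π₁-⟨,⟩ k ⟨ i , xs ⟩ | π₂-⟨,⟩ k ⟨ i , xs ⟩ | π₁-⟨,⟩ i xs | π₂-⟨,⟩ i xs = refl

step-precF-done : ∀ v eg k xs K → step (returnS v (cons (precF eg k k xs) K)) ≡ returnS v K
step-precF-done v eg k xs K rewrite step-precF v eg k k xs K | ∣n-n∣≡0 k = refl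

step-precF-next : ∀ v eg k i xs K → i < k → step (returnS v (cons (precF eg k i xs) K)) ≡
                  evalS eg (cons i (cons v xs)) (cons (precF eg k (suc i) xs) K)
step-precF-next v eg k i xs K i<k rewrite step-precF v eg k i xs K =
  ifz-≢0 ∣ i - k ∣ _ _ (λ eq → <-irrefl (∣m-n∣≡0⇒m≡n eq) i<k)

step-muF : ∀ v ef m xs K → step (returnS v (cons (muF ef m xs) K)) ≡ muFrameStep v K ef m xs
step-muF v ef m xs K rewrite step-frame v 2 ⟨ ef , ⟨ m , xs ⟩ ⟩ K
  | π₁-⟨,⟩ ef ⟨ m , xs ⟩ | π₂-⟨,⟩ ef ⟨ m , xs ⟩ | π₁-⟨,⟩ m xs | π₂-⟨,⟩ m xs = refl

step-args-cons : ∀ ef g gs xs acc K →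
                 step (argsS ef (cons g gs) xs acc K) ≡ evalS g xs (cons (compF ef gs xs acc) K)
step-args-cons ef g gs xs acc K rewrite step-argsS ef (cons g gs) xs acc K | hd-cons g gs | tl-cons g gs = refl

steps : ℕ → ℕ → ℕ
steps zero    s = s
steps (suc t) s = steps t (step s)

steps-+ : ∀ a b s → steps (a + b) s ≡ steps b (steps a s)
steps-+ zero    b s = refl
steps-+ (suc a) b s = steps-+ a b (step s)

infix  4 _↠_
infixr 5 _◅_ _◅◅_

_↠_ : ℕ → ℕ → Set
s ↠ s' = ∃ λ t → steps t s ≡ s'

↠-refl : ∀ {s} → s ↠ s
↠-refl = 0 , refl

_◅◅_ : ∀ {a b c} → a ↠ b → b ↠ c → a ↠ c
_◅◅_ {a} (t , eq) (u , eq') = t + u , trans (steps-+ t u a) (trans (cong (steps u) eq) eq')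

_◅_ : ∀ {a b c} → step a ≡ b → b ↠ c → a ↠ c
eq ◅ (t , eq') = suc t , trans (cong (steps t) eq) eq'

mutual
  simulate : ∀ {n} {c : Code n} {xs v} → Eval noOracle c xs v → ∀ K →
             evalS (encode c) (encodeVec xs) K ↠ returnS v K
  simulate e-zer K = step-evalS 0 0 _ K ◅ ↠-refl
  simulate (e-succ {x}) K = trans (step-evalS 1 0 _ K) (cong (λ z → returnS (suc z) K) (hd-cons x 0)) ◅ ↠-refl
  simulate (e-proj {i = i} {xs = xs}) K =
    trans (step-evalS 2 (toℕ i) _ K) (cong (λ z → returnS z K) (nth-encodeVec xs i)) ◅ ↠-refl
  simulate (e-orac ())
  simulate (e-comp {f = f} {gs = gs} {xs = xs} {ys = ys} args body) K =
    start ◅ simulate-args args (encode f) 0 0 K ◅◅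
    step-argsS (encode f) 0 (encodeVec xs) (encodeVec ys) K ◅ simulate body K
    where
    start : step (evalS (encode (comp f gs)) (encodeVec xs) K) ≡
            argsS (encode f) (encodeArgs gs 0) (encodeVec xs) 0 K
    start rewrite step-evalS 4 ⟨ encode f , encodeArgs gs 0 ⟩ (encodeVec xs) K
                | π₁-⟨,⟩ (encode f) (encodeArgs gs 0) | π₂-⟨,⟩ (encode f) (encodeArgs gs 0) = refl
  simulate {c = prec f g} {xs = k ∷ xs} {v} d K =
    start ◅ simulate-precLoop d k K ≤-refl ◅◅ step-precF-done v (encode g) k (encodeVec xs) K ◅ ↠-refl
    where
    start : step (evalS (encode (prec f g)) (encodeVec (k ∷ xs)) K) ≡
            evalS (encode f) (encodeVec xs) (cons (precF (encode g) k 0 (encodeVec xs)) K)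
    start rewrite step-evalS 5 ⟨ encode f , encode g ⟩ (encodeVec (k ∷ xs)) K
                | π₁-⟨,⟩ (encode f) (encode g) | π₂-⟨,⟩ (encode f) (encode g)
                | hd-cons k (encodeVec xs) | tl-cons k (encodeVec xs) = refl
  simulate {c = mu f} {xs = xs} (e-mu {m = m} d₀ below) K =
    step-evalS 6 (encode f) (encodeVec xs) K ◅ simulate-below below K ◅◅ simulate d₀ _ ◅◅
    step-muF 0 (encode f) m (encodeVec xs) K ◅ ↠-refl

  simulate-precLoop : ∀ {n} {f : Code n} {g} {k xs u} → Eval noOracle (prec f g) (k ∷ xs) u → ∀ N K → k ≤ N →
                      evalS (encode f) (encodeVec xs) (cons (precF (encode g) N 0 (encodeVec xs)) K) ↠
                      returnS u (cons (precF (encode g) N k (encodeVec xs)) K)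
  simulate-precLoop (e-prec0 d) N K _ = simulate d _
  simulate-precLoop {g = g} {k = suc k} {xs = xs} (e-precS {u = u} d dg) N K k<N =
    simulate-precLoop d N K (≤-trans (n≤1+n k) k<N) ◅◅
    step-precF-next u (encode g) N k (encodeVec xs) K k<N ◅ simulate dg _

  simulate-args : ∀ {n m} {xs : Vec ℕ n} {gs : Vec (Code n) m} {vs} → EvalAll noOracle xs gs vs →
                  ∀ ef R A K → argsS ef (encodeArgs gs R) (encodeVec xs) A K ↠
                               argsS ef R (encodeVec xs) (pushVec vs A) K
  simulate-args [] ef R A K = ↠-refl
  simulate-args {xs = xs} (_∷_ {g = g} {v = v} {vs = vs} d ds) ef R A K =
    simulate-args ds ef (cons (encode g) R) A K ◅◅
    step-args-cons ef (encode g) R (encodeVec xs) (pushVec vs A) K ◅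
    simulate d _ ◅◅ step-compF v ef R (encodeVec xs) (pushVec vs A) K ◅ ↠-refl

  simulate-below : ∀ {n} {f : Code (suc n)} {xs m} → Below noOracle f xs m → ∀ K →
                   evalS (encode f) (cons 0 (encodeVec xs)) (cons (muF (encode f) 0 (encodeVec xs)) K) ↠
                   evalS (encode f) (cons m (encodeVec xs)) (cons (muF (encode f) m (encodeVec xs)) K)
  simulate-below b-zero K = ↠-refl
  simulate-below {f = f} {xs} (b-suc {m} {w} below d) K =
    simulate-below below K ◅◅ simulate d _ ◅◅ step-muF (suc w) (encode f) m (encodeVec xs) K ◅ ↠-refl

mu-finds : ∀ {O n H} (h : Prim (suc n) H) xs t → H (t ∷ xs) ≡ 0 →
           ∃ λ t₀ → H (t₀ ∷ xs) ≡ 0 × Eval O (mu (code h)) xs t₀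
mu-finds {O} {H = H} h xs t H[t]≡0 = search 0 b-zero t refl
  where
  search : ∀ k → Below O (code h) xs k → ∀ d → k + d ≡ t → ∃ λ t₀ → H (t₀ ∷ xs) ≡ 0 × Eval O (mu (code h)) xs t₀
  search k below d k+d≡t with H (k ∷ xs) in H[k]≡
  ... | zero = k , H[k]≡ , e-mu (subst (Eval O (code h) (k ∷ xs)) H[k]≡ (runs h _)) below
  search k below zero    k+0≡t | suc w
    with () ← trans (sym H[k]≡) (trans (cong (λ z → H (z ∷ xs)) (trans (sym (+-identityʳ k)) k+0≡t)) H[t]≡0)
  search k below (suc d) k+d≡t | suc w =
    search (suc k) (b-suc below (subst (Eval O (code h) (k ∷ xs)) H[k]≡ (runs h _))) d (trans (sym (+-suc k d)) k+d≡t)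

initial : ℕ → ℕ → ℕ
initial x e = evalS e (cons x 0) 0

running : ℕ → ℕ
running s = ∣ π₁ s - 1 ∣ + π₂ (π₂ s)

config : ℕ → ℕ → ℕ → ℕ
config t x e = steps t (initial x e)

output : ℕ → ℕ → ℕ → ℕ
output t x e = π₁ (π₂ (config t x e))

Halts : ℕ → ℕ → Set
Halts x e = ∃ λ t → running (config t x e) ≡ 0

primSteps : Prim 2 (λ xs → steps (arg₀ xs) (arg₁ xs))
primSteps = cast rec≗steps (primRec var₀ (comp₁ primStep var₁))
  where
  steps-suc : ∀ t s → steps (suc t) s ≡ step (steps t s)
  steps-suc zero    s = refl
  steps-suc (suc t) s = steps-suc t (step s)
  rec≗steps : ∀ xs → rec arg₀ (λ ys → step (arg₁ ys)) xs ≡ steps (arg₀ xs) (arg₁ xs)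
  rec≗steps (zero  ∷ s ∷ []) = refl
  rec≗steps (suc t ∷ s ∷ []) = trans (cong step (rec≗steps (t ∷ s ∷ []))) (sym (steps-suc t s))

primConfig : Prim 3 (λ xs → config (arg₀ xs) (arg₁ xs) (arg₂ xs))
primConfig = comp₂ primSteps var₀ (evalSᵖ var₂ (consᵖ var₁ (constᵖ 0)) (constᵖ 0))

primRunning : Prim 3 (λ xs → running (config (arg₀ xs) (arg₁ xs) (arg₂ xs)))
primRunning = comp₁ (∣ π₁ᵖ var₀ - constᵖ 1 ∣ᵖ +ᵖ π₂ᵖ (π₂ᵖ var₀)) primConfig

primOutput : Prim 3 (λ xs → output (arg₀ xs) (arg₁ xs) (arg₂ xs))
primOutput = π₁ᵖ (π₂ᵖ primConfig)

-- Ψ(x, e): the output of the program with code number e on input x.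
Ψ : Code 2
Ψ = comp (code primOutput) (mu (code primRunning) ∷ proj fz ∷ proj (fs fz) ∷ [])

running≡0⇒halted : ∀ s → running s ≡ 0 → s ≡ returnS (π₁ (π₂ s)) 0
running≡0⇒halted s running≡0 = begin
  s                                     ≡⟨ sym (⟨π₁,π₂⟩ s) ⟩
  ⟨ π₁ s , π₂ s ⟩                        ≡⟨ cong ⟨_, π₂ s ⟩ π₁≡1 ⟩
  ⟨ 1 , π₂ s ⟩                           ≡⟨ sym (cong ⟨ 1 ,_⟩ (⟨π₁,π₂⟩ (π₂ s))) ⟩
  ⟨ 1 , ⟨ π₁ (π₂ s) , π₂ (π₂ s) ⟩ ⟩       ≡⟨ cong (λ K → returnS (π₁ (π₂ s)) K) π₂π₂≡0 ⟩
  returnS (π₁ (π₂ s)) 0                 ∎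
  where
  open ≡-Reasoning
  π₁≡1 : π₁ s ≡ 1
  π₁≡1 = ∣m-n∣≡0⇒m≡n (m+n≡0⇒m≡0 _ running≡0)
  π₂π₂≡0 : π₂ (π₂ s) ≡ 0
  π₂π₂≡0 = m+n≡0⇒n≡0 ∣ π₁ s - 1 ∣ running≡0

running-halted : ∀ v → running (returnS v 0) ≡ 0
running-halted v rewrite π₁-⟨,⟩ 1 ⟨ v , 0 ⟩ | π₂-⟨,⟩ 1 ⟨ v , 0 ⟩ = π₂-⟨,⟩ v 0

output-halted : ∀ v → π₁ (π₂ (returnS v 0)) ≡ v
output-halted v rewrite π₂-⟨,⟩ 1 ⟨ v , 0 ⟩ = π₁-⟨,⟩ v 0

steps-halted : ∀ d v → steps d (returnS v 0) ≡ returnS v 0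
steps-halted zero    v = refl
steps-halted (suc d) v = trans (cong (steps d) (step-halted v)) (steps-halted d v)

steps-deterministic-≤ : ∀ s t t' v v' → t ≤ t' → steps t s ≡ returnS v 0 → steps t' s ≡ returnS v' 0 → v ≡ v'
steps-deterministic-≤ s t t' v v' t≤t' eq eq' = proj₁ (⟨,⟩-injective (proj₂ (⟨,⟩-injective (begin
  returnS v 0                     ≡⟨ sym (steps-halted (t' ∸ t) v) ⟩
  steps (t' ∸ t) (returnS v 0)    ≡⟨ sym (cong (steps (t' ∸ t)) eq) ⟩
  steps (t' ∸ t) (steps t s)      ≡⟨ sym (steps-+ t (t' ∸ t) s) ⟩
  steps (t + (t' ∸ t)) s          ≡⟨ cong (λ z → steps z s) (m+[n∸m]≡n t≤t') ⟩
  steps t' s                      ≡⟨ eq' ⟩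
  returnS v' 0                    ∎))))
  where open ≡-Reasoning

output-unique : ∀ t t' x e → running (config t x e) ≡ 0 → running (config t' x e) ≡ 0 → output t x e ≡ output t' x e
output-unique t t' x e h h' with ≤-total t t'
... | inj₁ t≤t' = steps-deterministic-≤ _ t t' _ _ t≤t' (running≡0⇒halted _ h) (running≡0⇒halted _ h')
... | inj₂ t'≤t = sym (steps-deterministic-≤ _ t' t _ _ t'≤t (running≡0⇒halted _ h') (running≡0⇒halted _ h))

Ψ-computes : ∀ {O} x e t → running (config t x e) ≡ 0 → Eval O Ψ (x ∷ e ∷ []) (output t x e)
Ψ-computes {O} x e t h =
  let t₀ , h₀ , mu-eval = mu-finds {O} primRunning (x ∷ e ∷ []) t h
  in subst (Eval O Ψ (x ∷ e ∷ [])) (output-unique t₀ t x e h₀ h)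
       (e-comp (mu-eval ∷ e-proj ∷ e-proj ∷ []) (runs primOutput _))

simulate-total : ∀ {b : ℕ → ℕ} (c : Code 1) → (∀ x → Eval noOracle c (x ∷ []) (b x)) →
                 ∀ x → ∃ λ t → running (config t x (encode c)) ≡ 0 × output t x (encode c) ≡ b x
simulate-total {b} c eval x with simulate (eval x) 0
... | t , config≡ = t , trans (cong running config≡) (running-halted (b x)) ,
                        trans (cong (λ s → π₁ (π₂ s)) config≡) (output-halted (b x))

-- Bounded oracle computations

restrict-< : ∀ β n y → y < n → restrict β n y ≡ just (β y)
restrict-< β n y y<n = cong (λ b → if b then just (β y) else nothing) (dec-true (y <? n) y<n)

module _ {n : ℕ} where
  apply₁ : ∀ {F} → Prim 1 F → Code n → Code n
  apply₁ f a = comp (code f) (a ∷ [])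

  apply₂ : ∀ {F} → Prim 2 F → Code n → Code n → Code n
  apply₂ f a b = comp (code f) (a ∷ b ∷ [])

  apply₃ : ∀ {F} → Prim 3 F → Code n → Code n → Code n → Code n
  apply₃ f a b c = comp (code f) (a ∷ b ∷ c ∷ [])

module _ {O : Oracle} {n : ℕ} where

  apply₁-eval : ∀ {F} (f : Prim 1 F) {a : Code n} {xs u} → Eval O a xs u → Eval O (apply₁ f a) xs (F (u ∷ []))
  apply₁-eval f ea = e-comp (ea ∷ []) (runs f _)

  apply₂-eval : ∀ {F} (f : Prim 2 F) {a b : Code n} {xs u v} → Eval O a xs u → Eval O b xs v →
                Eval O (apply₂ f a b) xs (F (u ∷ v ∷ []))
  apply₂-eval f ea eb = e-comp (ea ∷ eb ∷ []) (runs f _)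

  apply₃-eval : ∀ {F} (f : Prim 3 F) {a b c : Code n} {xs u v w} → Eval O a xs u → Eval O b xs v → Eval O c xs w →
                Eval O (apply₃ f a b c) xs (F (u ∷ v ∷ w ∷ []))
  apply₃-eval f ea eb ec = e-comp (ea ∷ eb ∷ ec ∷ []) (runs f _)

-- Composition evaluates all of its arguments, so a conditional that must not run its second
-- branch is made from primitive recursion on a selector with value 0 or 1.
guarded : Code 1 → Code 1 → Code 1 → Code 1
guarded s a b = comp (prec a (comp b (proj (fs (fs fz)) ∷ []))) (s ∷ proj fz ∷ [])

module _ {O : Oracle} {s a b : Code 1} {x v : ℕ} where
  guarded-0 : Eval O s (x ∷ []) 0 → Eval O a (x ∷ []) v → Eval O (guarded s a b) (x ∷ []) v
  guarded-0 es ea = e-comp (es ∷ e-proj ∷ []) (e-prec0 ea)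

  guarded-1 : ∀ {u} → Eval O s (x ∷ []) 1 → Eval O a (x ∷ []) u → Eval O b (x ∷ []) v →
              Eval O (guarded s a b) (x ∷ []) v
  guarded-1 es ea eb = e-comp (es ∷ e-proj ∷ []) (e-precS (e-prec0 ea) (e-comp (e-proj ∷ []) eb))

sumBelow : (ℕ → ℕ) → ℕ → ℕ
sumBelow h zero    = 0
sumBelow h (suc k) = sumBelow h k + h k

sumBelow-zero : ∀ h k → (∀ y → y < k → h y ≡ 0) → sumBelow h k ≡ 0
sumBelow-zero h zero    h≡0 = refl
sumBelow-zero h (suc k) h≡0 =
  cong₂ _+_ (sumBelow-zero h k (λ y y<k → h≡0 y (≤-trans y<k (n≤1+n k)))) (h≡0 k ≤-refl)

sumBelow-single : ∀ h k j → j < k → (∀ y → y < k → y ≢ j → h y ≡ 0) → sumBelow h k ≡ h j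
sumBelow-single h (suc k) j j<1+k h≡0 with m≤n⇒m<n∨m≡n (≤-pred j<1+k)
... | inj₁ j<k = trans (cong₂ _+_ (sumBelow-single h k j j<k (λ y y<k → h≡0 y (≤-trans y<k (n≤1+n k))))
                                   (h≡0 k ≤-refl (λ k≡j → <-irrefl (sym k≡j) j<k)))
                       (+-identityʳ (h j))
... | inj₂ refl = cong (_+ h j) (sumBelow-zero h j (λ y y<j → h≡0 y (≤-trans y<j (n≤1+n j)) (<⇒≢ y<j)))

-- querySum q h computes ∑_{y < k} h (y , β (q (y , n)) , n) on input (k , n) relative to β.
querySum : ∀ {Q H} → Prim 2 Q → Prim 3 H → Code 2
querySum q h = prec zer
  (apply₂ prim+ (proj (fs fz))
          (apply₃ h (proj fz) (comp orac (apply₂ q (proj fz) (proj (fs (fs fz))) ∷ [])) (proj (fs (fs fz)))))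

querySum-eval : ∀ {Q H} (q : Prim 2 Q) (h : Prim 3 H) β bound n k →
                (∀ y → y < k → Q (y ∷ n ∷ []) < bound) →
                Eval (restrict β bound) (querySum q h) (k ∷ n ∷ [])
                     (sumBelow (λ y → H (y ∷ β (Q (y ∷ n ∷ [])) ∷ n ∷ [])) k)
querySum-eval q h β bound n zero    _       = e-prec0 e-zer
querySum-eval q h β bound n (suc k) queries =
  e-precS (querySum-eval q h β bound n k (λ y y<k → queries y (≤-trans y<k (n≤1+n k))))
    (apply₂-eval prim+ e-proj (apply₃-eval h e-proj
      (e-comp (apply₂-eval q e-proj e-proj ∷ []) (e-orac (restrict-< β bound _ (queries k ≤-refl)))) e-proj))

-- The graph of a function

graph? : ∀ (f : ℕ → ℕ) n → Dec (∃ λ x → pair x (f x) ≡ n)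
graph? f n with any? (λ x → pair x (f x) ≟ n) (upTo (suc n))
... | yes hit  = yes (satisfied hit)
... | no  miss = no λ (x , eq) → miss (lose (∈-upTo⁺ (s≤s (≤-trans (x≤pair[x,y] x (f x)) (≤-reflexive eq)))) eq)

graphχ-∈ : ∀ (f : ℕ → ℕ) n x → pair x (f x) ≡ n → graphχ f n ≡ 1
graphχ-∈ f n x eq = cong (λ b → if b then 1 else 0)
  (dec-true (any? (λ x → pair x (f x) ≟ n) (upTo (suc n)))
     (lose (∈-upTo⁺ (s≤s (≤-trans (x≤pair[x,y] x (f x)) (≤-reflexive eq)))) eq))

graphχ-∉ : ∀ (f : ℕ → ℕ) n → (∀ x → pair x (f x) ≢ n) → graphχ f n ≡ 0
graphχ-∉ f n miss = cong (λ b → if b then 1 else 0)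
  (dec-false (any? (λ x → pair x (f x) ≟ n) (upTo (suc n))) (λ hit → miss _ (proj₂ (satisfied hit))))

graphχ-off : ∀ (f : ℕ → ℕ) x y → y ≢ f x → graphχ f (pair x y) ≡ 0
graphχ-off f x y y≢fx = graphχ-∉ f _ λ x' eq →
  let x'≡x , fx'≡y = pair-injective {x'} {f x'} {x} {y} eq in y≢fx (trans (sym fx'≡y) (cong f x'≡x))

-- A single query per candidate value finds f a, since exactly one term is nonzero.
sumBelow-graphχ : ∀ (f : ℕ → ℕ) a k → f a < k → sumBelow (λ y → y * graphχ f (pair a y)) k ≡ f a
sumBelow-graphχ f a k fa<k = begin
  sumBelow (λ y → y * graphχ f (pair a y)) k ≡⟨ sumBelow-single _ k (f a) fa<k off-graph ⟩
  f a * graphχ f (pair a (f a))              ≡⟨ cong (f a *_) (graphχ-∈ f _ a refl) ⟩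
  f a * 1                                    ≡⟨ *-identityʳ (f a) ⟩
  f a                                        ∎
  where
  open ≡-Reasoning
  off-graph : ∀ y → y < k → y ≢ f a → y * graphχ f (pair a y) ≡ 0
  off-graph y _ y≢fa = trans (cong (y *_) (graphχ-off f a y y≢fa)) (*-zeroʳ y)

χ≡ : ℕ → ℕ → ℕ
χ≡ a b = ifz ∣ a - b ∣ 1 0

χ≡-refl : ∀ a → χ≡ a a ≡ 1
χ≡-refl a rewrite ∣n-n∣≡0 a = refl

χ≡-≢ : ∀ {a b} → a ≢ b → χ≡ a b ≡ 0
χ≡-≢ a≢b = ifz-≢0 _ 1 0 (λ eq → a≢b (∣m-n∣≡0⇒m≡n eq))

sumBelow-χ≡-graph : ∀ (f : ℕ → ℕ) n → sumBelow (λ y → χ≡ (pair y (f y)) n) (suc n) ≡ graphχ f n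
sumBelow-χ≡-graph f n with graph? f n
... | yes (x , eq) = begin
  sumBelow (λ y → χ≡ (pair y (f y)) n) (suc n) ≡⟨ sumBelow-single _ (suc n) x x<1+n others ⟩
  χ≡ (pair x (f x)) n                          ≡⟨ cong (λ z → χ≡ z n) eq ⟩
  χ≡ n n                                       ≡⟨ χ≡-refl n ⟩
  1                                            ≡⟨ sym (graphχ-∈ f n x eq) ⟩
  graphχ f n                                   ∎
  where
  open ≡-Reasoning
  x<1+n : x < suc n
  x<1+n = s≤s (≤-trans (x≤pair[x,y] x (f x)) (≤-reflexive eq))
  others : ∀ y → y < suc n → y ≢ x → χ≡ (pair y (f y)) n ≡ 0
  others y _ y≢x = χ≡-≢ (λ eq' → y≢x (proj₁ (pair-injective (trans eq' (sym eq)))))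
... | no miss = trans (sumBelow-zero _ (suc n) (λ y _ → χ≡-≢ (λ eq → miss (y , eq))))
                      (sym (graphχ-∉ f n (λ x eq → miss (x , eq))))

graphχ≤bT : ∀ (f : ℕ → ℕ) → graphχ f ≤bT f
graphχ≤bT f = comp (querySum var₀ member) (code (sucᵖ var₀) ∷ proj fz ∷ []) , suc ,
              (code (sucᵖ var₀) , λ n → runs (sucᵖ var₀) (n ∷ [])) ,
              λ n → subst (Eval (restrict f (suc n)) _ (n ∷ [])) (sumBelow-χ≡-graph f n)
                      (e-comp (runs (sucᵖ var₀) _ ∷ e-proj ∷ [])
                              (querySum-eval var₀ member f (suc n) n (suc n) (λ y y<1+n → y<1+n)))
  where
  member : Prim 3 (λ xs → χ≡ (pair (arg₀ xs) (arg₁ xs)) (arg₂ xs))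
  member = ifzᵖ ∣ pairᵖ var₀ var₁ - var₂ ∣ᵖ (constᵖ 1) (constᵖ 0)

-- A function that is not computably bounded

parity : ℕ → ℕ
parity zero    = 0
parity (suc n) = 1 ∸ parity n

half : ℕ → ℕ
half zero    = 0
half (suc n) = half n + parity n

parity-double : ∀ x → parity (x + x) ≡ 0
parity-double zero    = refl
parity-double (suc x) rewrite +-suc x x | parity-double x = refl

half-double : ∀ x → half (x + x) ≡ x
half-double zero    = refl
half-double (suc x) rewrite +-suc x x | parity-double x | half-double x =
  trans (+-comm (x + 0) 1) (cong suc (+-identityʳ x))

parity-suc-double : ∀ x → parity (suc (x + x)) ≡ 1
parity-suc-double x rewrite parity-double x = refl

half-suc-double : ∀ x → half (suc (x + x)) ≡ x
half-suc-double x rewrite parity-double x | half-double x = +-identityʳ x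

even-or-odd : ∀ m → (parity m ≡ 0 × m ≡ half m + half m) ⊎ (parity m ≡ 1 × m ≡ suc (half m + half m))
even-or-odd zero = inj₁ (refl , refl)
even-or-odd (suc m) with even-or-odd m
... | inj₁ (p≡0 , m≡) rewrite p≡0 = inj₂ (refl , cong suc (trans m≡ (sym (cong₂ _+_ h+0≡h h+0≡h))))
  where h+0≡h = +-identityʳ (half m)
... | inj₂ (p≡1 , m≡) rewrite p≡1 = inj₁ (refl , trans (cong suc m≡) (sym h+1+[h+1]≡2+h+h))
  where
  h+1+[h+1]≡2+h+h : half m + 1 + (half m + 1) ≡ suc (suc (half m + half m))
  h+1+[h+1]≡2+h+h = trans (cong₂ _+_ (+-comm (half m) 1) (+-comm (half m) 1)) (cong suc (+-suc (half m) (half m)))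

primParity : Prim 1 (λ xs → parity (arg₀ xs))
primParity = cast rec≗parity (primRec (constᵖ 0) (constᵖ 1 ∸ᵖ var₁))
  where
  rec≗parity : ∀ xs → rec (λ _ → 0) (λ ys → 1 ∸ arg₁ ys) xs ≡ parity (arg₀ xs)
  rec≗parity (zero  ∷ []) = refl
  rec≗parity (suc k ∷ []) = cong (1 ∸_) (rec≗parity (k ∷ []))

primHalf : Prim 1 (λ xs → half (arg₀ xs))
primHalf = cast rec≗half (primRec (constᵖ 0) (var₁ +ᵖ comp₁ primParity var₀))
  where
  rec≗half : ∀ xs → rec (λ _ → 0) (λ ys → arg₁ ys + parity (arg₀ ys)) xs ≡ half (arg₀ xs)
  rec≗half (zero  ∷ []) = refl
  rec≗half (suc k ∷ []) = cong (_+ parity k) (rec≗half (k ∷ []))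

-- best g x is a pair (d , g d) with d ≤ x and g d maximal, if g is defined somewhere below x.
Candidate : Set
Candidate = Maybe (ℕ × ℕ)

consider : Candidate → ℕ → Maybe ℕ → Candidate
consider c               e nothing  = c
consider nothing         e (just w) = just (e , w)
consider (just (d , w')) e (just w) with w ≤? w'
... | yes _ = just (d , w')
... | no  _ = just (e , w)

best : (ℕ → Maybe ℕ) → ℕ → Candidate
best g zero    = consider nothing 0 (g 0)
best g (suc x) = consider (best g x) (suc x) (g (suc x))

index⁺ : Candidate → ℕ
index⁺ nothing        = 0
index⁺ (just (d , _)) = suc d

value⁺ : Candidate → ℕ
value⁺ nothing        = 0
value⁺ (just (_ , w)) = suc w

Attained : (ℕ → Maybe ℕ) → ℕ → Candidate → Set
Attained g x nothing        = ⊤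
Attained g x (just (d , w)) = d ≤ x × g d ≡ just w

best-attained : ∀ g x → Attained g x (best g x)
best-attained g zero with g 0 in g0≡
... | nothing = _
... | just w  = z≤n , g0≡
best-attained g (suc x) = consider-attained (best g x) (best-attained g x)
  where
  consider-attained : ∀ c → Attained g x c → Attained g (suc x) (consider c (suc x) (g (suc x)))
  consider-attained c att with g (suc x) in g≡
  consider-attained nothing         _          | nothing = _
  consider-attained (just (d , w')) (d≤x , eq) | nothing = ≤-trans d≤x (n≤1+n x) , eq
  consider-attained nothing         _          | just w  = ≤-refl , g≡
  consider-attained (just (d , w')) (d≤x , eq) | just w with w ≤? w'
  ... | yes _ = ≤-trans d≤x (n≤1+n x) , eq
  ... | no  _ = ≤-refl , g≡

consider-keeps : ∀ c e r w → w < value⁺ c → w < value⁺ (consider c e r)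
consider-keeps c               e nothing    w w<c = w<c
consider-keeps (just (d , w')) e (just w'') w w<c with w'' ≤? w'
... | yes _    = w<c
... | no  w''≰w' = ≤-trans w<c (<⇒≤ (s≤s (≰⇒> w''≰w')))

consider-new : ∀ c e w → w < value⁺ (consider c e (just w))
consider-new nothing         e w = ≤-refl
consider-new (just (d , w')) e w with w ≤? w'
... | yes w≤w' = s≤s w≤w'
... | no  _    = ≤-refl

best-dominates : ∀ g x e w → e ≤ x → g e ≡ just w → w < value⁺ (best g x)
best-dominates g zero    zero w z≤n g≡ rewrite g≡ = ≤-refl
best-dominates g (suc x) e    w e≤1+x g≡ with m≤n⇒m<n∨m≡n e≤1+x
... | inj₁ e<1+x = consider-keeps (best g x) (suc x) (g (suc x)) w (best-dominates g x e w (≤-pred e<1+x) g≡)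
... | inj₂ refl rewrite g≡ = consider-new (best g x) (suc x) w

evenPart : ℕ → ℕ
evenPart m = half m + half m

queryBound : ℕ → ℕ
queryBound m = suc (pair m (suc m))

primQueryBound : Prim 1 (λ xs → queryBound (arg₀ xs))
primQueryBound = sucᵖ (pairᵖ var₀ (sucᵖ var₀))

evenPartQuery : Prim 2 (λ xs → pair (evenPart (arg₁ xs)) (arg₀ xs))
evenPartQuery = pairᵖ (comp₁ primHalf var₁ +ᵖ comp₁ primHalf var₁) var₀

indexSearch : Code 1
indexSearch = comp (querySum evenPartQuery (var₀ *ᵖ var₁)) (code (sucᵖ (sucᵖ (comp₁ primHalf var₀))) ∷ proj fz ∷ [])

indexSearch-eval : ∀ (f : ℕ → ℕ) m → f (evenPart m) ≤ suc (half m) →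
                   Eval (restrict (graphχ f) (queryBound m)) indexSearch (m ∷ []) (f (evenPart m))
indexSearch-eval f m small =
  subst (Eval (restrict (graphχ f) (queryBound m)) indexSearch (m ∷ []))
        (sumBelow-graphχ f (evenPart m) (suc (suc (half m))) (s≤s small))
        (e-comp (runs (sucᵖ (sucᵖ (comp₁ primHalf var₀))) _ ∷ e-proj ∷ [])
                (querySum-eval evenPartQuery (var₀ *ᵖ var₁) (graphχ f) (queryBound m) m _ in-bound))
  where
  evenPart≤m : evenPart m ≤ m
  evenPart≤m with even-or-odd m
  ... | inj₁ (_ , m≡) = ≤-reflexive (sym m≡)
  ... | inj₂ (_ , m≡) = ≤-trans (n≤1+n _) (≤-reflexive (sym m≡))
  half≤m : half m ≤ m
  half≤m = ≤-trans (m≤m+n (half m) (half m)) evenPart≤m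
  in-bound : ∀ y → y < suc (suc (half m)) → pair (evenPart m) y < queryBound m
  in-bound y y<2+h = s≤s (pair-mono-≤ evenPart≤m (≤-trans (≤-pred y<2+h) (s≤s half≤m)))

oddAndFound : Code 1
oddAndFound = apply₂ (var₀ *ᵖ ifzᵖ var₁ (constᵖ 0) (constᵖ 1)) (code primParity) indexSearch

evenAnswer : Code 1
evenAnswer = apply₃ primIfz (code primParity) indexSearch zer

ΨAnswer : Code 1
ΨAnswer = comp succ (comp Ψ (proj fz ∷ apply₁ primPred indexSearch ∷ []) ∷ [])

-- On m = 2x+1 with f (2x) = d + 1 this outputs Ψ (m , d) + 1; otherwise f (2x) if m is even
-- and 0 if m is odd.
reduction : Code 1
reduction = guarded oddAndFound evenAnswer ΨAnswer

module _ (lem : ExcludedMiddle 0ℓ) where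

  haltValue : ℕ → ℕ → Maybe ℕ
  haltValue x e with lem {Halts x e}
  ... | yes (t , _) = just (output t x e)
  ... | no  _       = nothing

  haltValue-just : ∀ x e w → haltValue x e ≡ just w → ∃ λ t → running (config t x e) ≡ 0 × output t x e ≡ w
  haltValue-just x e w eq with lem {Halts x e}
  haltValue-just x e w refl | yes (t , h) = t , h , refl

  haltValue-halts : ∀ x e t → running (config t x e) ≡ 0 → haltValue x e ≡ just (output t x e)
  haltValue-halts x e t h with lem {Halts x e}
  ... | yes (t' , h') = cong just (output-unique t' t x e h' h)
  ... | no  ¬halts    = ⊥-elim (¬halts (t , h))

  champion : ℕ → Candidate
  champion x = best (haltValue (suc (x + x))) x

  f : ℕ → ℕ
  f m = ifz (parity m) (index⁺ (champion (half m))) (value⁺ (champion (half m)))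

  f-even : ∀ x → f (x + x) ≡ index⁺ (champion x)
  f-even x rewrite parity-double x | half-double x = refl

  f-odd : ∀ x → f (suc (x + x)) ≡ value⁺ (champion x)
  f-odd x rewrite parity-suc-double x | half-suc-double x = refl

  f-not-computably-bounded : ¬ ComputablyBounded f
  f-not-computably-bounded (b , (c , eval) , f≤b) = <-irrefl refl (≤-trans b[m]<f[m] (f≤b m))
    where
    e = encode c
    m = suc (e + e)
    b[m]<f[m] : b m < f m
    b[m]<f[m] with simulate-total c eval m
    ... | t , h , out≡ rewrite f-odd e =
      best-dominates (haltValue m) e e (b m) ≤-refl (trans (haltValue-halts m e t h) (cong just out≡))

  index⁺-champion-≤ : ∀ x → index⁺ (champion x) ≤ suc x
  index⁺-champion-≤ x with champion x | best-attained (haltValue (suc (x + x))) x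
  ... | nothing      | _         = z≤n
  ... | just (d , _) | (d≤x , _) = s≤s d≤x

  module _ (m : ℕ) where
    private
      O : Oracle
      O = restrict (graphχ f) (queryBound m)

      c : Candidate
      c = champion (half m)

    index-eval : Eval O indexSearch (m ∷ []) (index⁺ c)
    index-eval = subst (Eval O indexSearch (m ∷ [])) (f-even (half m))
                   (indexSearch-eval f m (≤-trans (≤-reflexive (f-even (half m))) (index⁺-champion-≤ (half m))))

    oddAndFound-eval : Eval O oddAndFound (m ∷ []) (parity m * ifz (index⁺ c) 0 1)
    oddAndFound-eval = apply₂-eval (var₀ *ᵖ ifzᵖ var₁ (constᵖ 0) (constᵖ 1)) (runs primParity (m ∷ [])) index-eval

    evenAnswer-eval : Eval O evenAnswer (m ∷ []) (ifz (parity m) (index⁺ c) 0)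
    evenAnswer-eval = apply₃-eval primIfz (runs primParity (m ∷ [])) index-eval e-zer

    ΨAnswer-eval : ∀ d w → m ≡ suc (half m + half m) → champion (half m) ≡ just (d , w) →
                   Eval O ΨAnswer (m ∷ []) (suc w)
    ΨAnswer-eval d w m≡ c≡ =
      e-comp (e-comp (e-proj ∷ apply₁-eval primPred index-eval-found ∷ []) Ψ-eval ∷ []) e-succ
      where
      index-eval-found : Eval O indexSearch (m ∷ []) (suc d)
      index-eval-found = subst (Eval O indexSearch (m ∷ [])) (cong index⁺ c≡) index-eval
      halts : haltValue m d ≡ just w
      halts = proj₂ (subst (Attained (haltValue m) (half m)) c≡
                (subst (λ z → Attained (haltValue z) (half m) c) (sym m≡) (best-attained _ (half m))))
      Ψ-eval : Eval O Ψ (m ∷ d ∷ []) w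
      Ψ-eval = let t , h , out≡ = haltValue-just m d w halts in
               subst (Eval O Ψ (m ∷ d ∷ [])) out≡ (Ψ-computes m d t h)

    f-when-even : parity m ≡ 0 → f m ≡ index⁺ c
    f-when-even p≡0 = cong (λ p → ifz p (index⁺ c) (value⁺ c)) p≡0

    f-when-odd : parity m ≡ 1 → f m ≡ value⁺ c
    f-when-odd p≡1 = cong (λ p → ifz p (index⁺ c) (value⁺ c)) p≡1

    oddAndFound-odd : parity m ≡ 1 → ∀ {c'} → champion (half m) ≡ c' →
                      Eval O oddAndFound (m ∷ []) (1 * ifz (index⁺ c') 0 1)
    oddAndFound-odd p≡1 c≡ =
      subst (Eval O oddAndFound (m ∷ [])) (cong₂ (λ p c' → p * ifz (index⁺ c') 0 1) p≡1 c≡) oddAndFound-eval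

    reduction-computes-odd : m ≡ suc (half m + half m) → parity m ≡ 1 →
                             ∀ c' → champion (half m) ≡ c' → Eval O reduction (m ∷ []) (value⁺ c')
    reduction-computes-odd m≡ p≡1 nothing c≡ =
      guarded-0 (oddAndFound-odd p≡1 c≡)
                (subst (Eval O evenAnswer (m ∷ [])) (cong₂ (λ p c' → ifz p (index⁺ c') 0) p≡1 c≡) evenAnswer-eval)
    reduction-computes-odd m≡ p≡1 (just (d , w)) c≡ =
      guarded-1 (oddAndFound-odd p≡1 c≡) evenAnswer-eval (ΨAnswer-eval d w m≡ c≡)

    reduction-computes-f : Eval O reduction (m ∷ []) (f m)
    reduction-computes-f = by-parity (even-or-odd m)
      where
      by-parity : (parity m ≡ 0 × m ≡ half m + half m) ⊎ (parity m ≡ 1 × m ≡ suc (half m + half m)) →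
                  Eval O reduction (m ∷ []) (f m)
      by-parity (inj₁ (p≡0 , _)) =
        guarded-0 (subst (Eval O oddAndFound (m ∷ [])) (cong (_* ifz (index⁺ c) 0 1) p≡0) oddAndFound-eval)
                  (subst (Eval O evenAnswer (m ∷ []))
                         (trans (cong (λ p → ifz p (index⁺ c) 0) p≡0) (sym (f-when-even p≡0))) evenAnswer-eval)
      by-parity (inj₂ (p≡1 , m≡)) = subst (Eval O reduction (m ∷ [])) (sym (f-when-odd p≡1))
                                      (reduction-computes-odd m≡ p≡1 c refl)

  f≤bTgraphχ : f ≤bT graphχ f
  f≤bTgraphχ = reduction , queryBound , (code primQueryBound , λ m → runs primQueryBound (m ∷ [])) ,
               reduction-computes-f

lemma2p8 : ExcludedMiddle 0ℓ →
    Σ (ℕ → ℕ) λ f → (¬ ComputablyBounded f) × (f ≡bT graphχ f)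
lemma2p8 lem = f lem , f-not-computably-bounded lem , f≤bTgraphχ lem , graphχ≤bT (f lem)
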